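{- Let $P$ be a property of groups that is Markov for the class of computable groups, witnessed by computable groups $G_+$ and $G_-$. Then detecting $P$ is $\Pi^0_1$-hard in the class of computable groups.
   Context: A group is computable if its universe is a computable subset of $\mathbb N$ and its group operation is computable; equivalently its atomic diagram (multiplication table) is computed by some partial computable function $\varphi_e$ in a fixed acceptable enumeration. The class of computable groups is identified with the set $A$ of indices $e$ such that $\varphi_e$ computes the atomic diagram of a group. For a complexity class $\Gamma$ of the arithmetical hierarchy and a group property $P$, let $B\subseteq A$ be the set of indices whose group has $P$. Detecting $P$ is $\Gamma$-hard in $A$ if for every $\Gamma$ set $S\subseteq\mathbb N$ there is a computable $f:\mathbb N\to A$ with $e\in S\iff f(e)\in B$. A property $P$ is Markov for a class $\mathcal C$ of groups, witnessed by $G_+,G_-\in\mathcal C$, if $G_+$ has $P$ and every group $H$ admitting an injective homomorphism from $G_-$ fails to have $P$. -}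

module Defs where

open import Level using (Level; 0ℓ) renaming (suc to lsuc)
open import Data.Nat using (ℕ; zero; suc; _+_; _<_)
open import Data.Nat.Properties using (≡-irrelevant)
open import Data.Product using (Σ; _×_; _,_; proj₁; proj₂)
open import Relation.Nullary using (¬_)
open import Relation.Binary.PropositionalEquality
  using (_≡_; refl; sym; trans; cong; cong₂; isEquivalence)
open import Function.Bundles using (_⇔_)
open import Algebra.Bundles using (Group)
open import Algebra.Morphism.Structures
  using (IsGroupIsomorphism; IsGroupMonomorphism)

-- Cantor pairing  ⟨a , b⟩ = T(a+b) + b,  T(d) = d(d+1)/2

tri : ℕ → ℕ
tri zero    = zero
tri (suc n) = suc n + tri n

pair : ℕ → ℕ → ℕ
pair a b = tri (a + b) + b

-- A concrete model of computation: (unary) partial recursive functions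
-- on ℕ in Kleene style, with Cantor pairing used for multiple arguments.

data Code : Set where
  zer sucᶜ idᶜ left right : Code
  comp  : Code → Code → Code
  pairᶜ : Code → Code → Code
  rec   : Code → Code → Code     -- primitive recursion on the 2nd component
  mu    : Code → Code

data Eval : Code → ℕ → ℕ → Set where
  ev-zer   : ∀ {x} → Eval zer x 0
  ev-suc   : ∀ {x} → Eval sucᶜ x (suc x)
  ev-id    : ∀ {x} → Eval idᶜ x x
  ev-left  : ∀ {a b} → Eval left (pair a b) a
  ev-right : ∀ {a b} → Eval right (pair a b) b
  ev-comp  : ∀ {f g x y z} → Eval g x y → Eval f y z → Eval (comp f g) x z
  ev-pair  : ∀ {f g x a b} → Eval f x a → Eval g x b → Eval (pairᶜ f g) x (pair a b)
  ev-rec0  : ∀ {f g x y} → Eval f x y → Eval (rec f g) (pair x 0) y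
  ev-recS  : ∀ {f g x n y z} → Eval (rec f g) (pair x n) y →
             Eval g (pair x (pair n y)) z → Eval (rec f g) (pair x (suc n)) z
  ev-mu    : ∀ {f x n} → Eval f (pair x n) 0 →
             (∀ m → m < n → Σ ℕ λ k → Eval f (pair x m) (suc k)) →
             Eval (mu f) x n

⌜_⌝ : Code → ℕ
⌜ zer ⌝       = pair 0 0
⌜ sucᶜ ⌝      = pair 1 0
⌜ idᶜ ⌝       = pair 2 0
⌜ left ⌝      = pair 3 0
⌜ right ⌝     = pair 4 0
⌜ comp f g ⌝  = pair 5 (pair ⌜ f ⌝ ⌜ g ⌝)
⌜ pairᶜ f g ⌝ = pair 6 (pair ⌜ f ⌝ ⌜ g ⌝)
⌜ rec f g ⌝   = pair 7 (pair ⌜ f ⌝ ⌜ g ⌝)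
⌜ mu f ⌝      = pair 8 ⌜ f ⌝

-- The enumeration φ:  φ e x ≃ y.  (Indices that code no program are nowhere defined.)
φ_[_]≃_ : ℕ → ℕ → ℕ → Set
φ e [ x ]≃ y = Σ Code λ c → ⌜ c ⌝ ≡ e × Eval c x y

Total : ℕ → Set
Total e = ∀ x → Σ ℕ λ y → φ e [ x ]≃ y

Computable : (ℕ → ℕ) → Set
Computable f = Σ ℕ λ c → ∀ n → φ c [ n ]≃ f n

IsΠ⁰₁ : (ℕ → Set) → Set
IsΠ⁰₁ S = Σ ℕ λ r → Total r × (∀ e → S e ⇔ (∀ n → φ r [ pair e n ]≃ 0))

-- Computable groups.  φ_e (total) computes the atomic diagram:
--   x is in the universe   iff  φ_e(⟨0,x⟩) = 0
--   x · y                  =    φ_e(⟨1,⟨x,y⟩⟩)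

module Diagram (v : ℕ → ℕ) where
  mem : ℕ → Set
  mem x = v (pair 0 x) ≡ 0

  mul : ℕ → ℕ → ℕ
  mul x y = v (pair 1 (pair x y))

  record GroupAxioms : Set where
    field
      closed   : ∀ x y → mem x → mem y → mem (mul x y)
      assoc    : ∀ x y z → mem x → mem y → mem z →
                 mul (mul x y) z ≡ mul x (mul y z)
      unit     : ℕ
      unit-mem : mem unit
      identityˡ : ∀ x → mem x → mul unit x ≡ x
      identityʳ : ∀ x → mem x → mul x unit ≡ x
      inverse  : ∀ x → mem x → Σ ℕ λ y → mem y × mul y x ≡ unit × mul x y ≡ unit

record IsCompGroup (e : ℕ) : Set where
  field
    total : Total e
  val : ℕ → ℕ
  val x = proj₁ (total x)
  field
    axioms : Diagram.GroupAxioms val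

toGroup : ∀ {e} → IsCompGroup e → Group 0ℓ 0ℓ
toGroup {e} w = record
  { Carrier = Σ ℕ mem
  ; _≈_ = λ a b → proj₁ a ≡ proj₁ b
  ; _∙_ = λ a b → mul (proj₁ a) (proj₁ b) , closed (proj₁ a) (proj₁ b) (proj₂ a) (proj₂ b)
  ; ε = unit , unit-mem
  ; _⁻¹ = λ a → proj₁ (inverse (proj₁ a) (proj₂ a)) , proj₁ (proj₂ (inverse (proj₁ a) (proj₂ a)))
  ; isGroup = record
    { isMonoid = record
      { isSemigroup = record
        { isMagma = record
          { isEquivalence = record { refl = refl ; sym = sym ; trans = trans }
          ; ∙-cong = λ p q → cong₂ mul p q }
        ; assoc = λ a b c → assoc (proj₁ a) (proj₁ b) (proj₁ c) (proj₂ a) (proj₂ b) (proj₂ c) }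
      ; identity = (λ a → identityˡ (proj₁ a) (proj₂ a)) , (λ a → identityʳ (proj₁ a) (proj₂ a)) }
    ; inverse = (λ a → proj₁ (proj₂ (proj₂ (inverse (proj₁ a) (proj₂ a)))))
              , (λ a → proj₂ (proj₂ (proj₂ (inverse (proj₁ a) (proj₂ a)))))
    ; ⁻¹-cong = inv-cong }
  }
  where
  open IsCompGroup w
  open Diagram val
  open GroupAxioms axioms
  inv-cong : ∀ {a b : Σ ℕ mem} → proj₁ a ≡ proj₁ b →
             proj₁ (inverse (proj₁ a) (proj₂ a)) ≡ proj₁ (inverse (proj₁ b) (proj₂ b))
  inv-cong {x , p} {.x , q} refl = cong (λ r → proj₁ (inverse x r)) (≡-irrelevant p q)

_≅_ : Group 0ℓ 0ℓ → Group 0ℓ 0ℓ → Set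
G ≅ H = Σ (Group.Carrier G → Group.Carrier H)
            (IsGroupIsomorphism (Group.rawGroup G) (Group.rawGroup H))

Embeds : Group 0ℓ 0ℓ → Group 0ℓ 0ℓ → Set
Embeds G H = Σ (Group.Carrier G → Group.Carrier H)
               (IsGroupMonomorphism (Group.rawGroup G) (Group.rawGroup H))

IsoInvariant : ∀ {p} → (Group 0ℓ 0ℓ → Set p) → Set (lsuc 0ℓ Level.⊔ p)
IsoInvariant P = ∀ G H → G ≅ H → P G → P H

record Markov {p} (P : Group 0ℓ 0ℓ → Set p) (G₊ G₋ : Group 0ℓ 0ℓ) : Set (lsuc 0ℓ Level.⊔ p) where
  field
    positive : P G₊
    negative : ∀ H → Embeds G₋ H → ¬ P H

HasP : ∀ {p} → (Group 0ℓ 0ℓ → Set p) → ℕ → Set p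
HasP P e = Σ (IsCompGroup e) λ w → P (toGroup w)

Π⁰₁-hard : ∀ {p} → (Group 0ℓ 0ℓ → Set p) → Set (lsuc 0ℓ Level.⊔ p)
Π⁰₁-hard P = ∀ (S : ℕ → Set) → IsΠ⁰₁ S →
  Σ (ℕ → ℕ) λ f → Computable f ×
    Σ (∀ e → IsCompGroup (f e)) λ _ →
      ∀ e → S e ⇔ HasP P (f e)

{-# OPTIONS --safe #-}
module Submission where

open import Defs
open import Level using (Level; 0ℓ)
open import Data.Nat
  using (ℕ; zero; suc; _+_; _∸_; _⊔_; pred; _≤_; _≟_; s≤s; _≤′_; ≤′-refl; ≤′-step)
open import Data.Nat.Properties
  using ( +-comm; +-suc; +-identityʳ; suc-injective; <-cmp; ≤⇒≤′; ≤-antisym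
        ; m≤m⊔n; m≤n⊔m; m⊔n≤o⇒m≤o; m⊔n≤o⇒n≤o; n∸n≡0; pred[m∸n]≡m∸[1+n]; m∸n≡0⇒m≤n)
open import Data.Product using (Σ; ∃; _×_; _,_; proj₁; proj₂; uncurry)
open import Data.Sum using (_⊎_; inj₁; inj₂; [_,_]′)
open import Data.Empty using (⊥-elim)
open import Function using (id)
open import Function.Bundles using (mk⇔; Equivalence)
open import Relation.Nullary using (¬_; yes; no)
open import Relation.Binary.Definitions using (tri<; tri≈; tri>)
open import Relation.Binary.PropositionalEquality
open import Algebra.Bundles using (Group)
open import Algebra.Morphism.Structures using (IsGroupMonomorphism; IsGroupIsomorphism)
import Algebra.Properties.Group as GroupProperties

-- Write S = {e | ∀ n. R(e,n)}.  From e we compute a diagram for a group Gₑ whose elements are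
-- triples ⟨a , b , s⟩ with a ∈ G₊ and b ∈ G₋, where s = 0 if b = 1 and otherwise s is the stage
-- at which the search for an n with ¬ R(e,n) first succeeds.  The tag s makes membership decidable
-- and is determined by b.  If e ∈ S no such stage exists, so Gₑ ≅ G₊ has P; if e ∉ S then
-- Gₑ ≅ G₊ × G₋ contains G₋, so Gₑ does not have P.

next : ℕ × ℕ → ℕ × ℕ
next (zero  , b) = suc b , 0
next (suc a , b) = a , suc b

unpair : ℕ → ℕ × ℕ
unpair zero    = 0 , 0
unpair (suc n) = next (unpair n)

fst snd : ℕ → ℕ
fst n = proj₁ (unpair n)
snd n = proj₂ (unpair n)

pair-next : ∀ p → uncurry pair (next p) ≡ suc (uncurry pair p)
pair-next (zero , b) = begin
  tri (suc b + 0) + 0   ≡⟨ +-identityʳ _ ⟩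
  tri (suc b + 0)       ≡⟨ cong (λ d → tri (suc d)) (+-identityʳ b) ⟩
  suc (b + tri b)       ≡⟨ cong suc (+-comm b (tri b)) ⟩
  suc (tri b + b)       ∎
  where open ≡-Reasoning
pair-next (suc a , b) = begin
  tri (a + suc b) + suc b   ≡⟨ cong (λ d → tri d + suc b) (+-suc a b) ⟩
  tri (suc a + b) + suc b   ≡⟨ +-suc _ b ⟩
  suc (tri (suc a + b) + b) ∎
  where open ≡-Reasoning

pair-unpair : ∀ n → pair (fst n) (snd n) ≡ n
pair-unpair zero    = refl
pair-unpair (suc n) = trans (pair-next (unpair n)) (cong suc (pair-unpair n))

-- Induction along the anti-diagonals a + b = d, walking each one from (d , 0) to (0 , d).
unpair-pair : ∀ a b → unpair (pair a b) ≡ (a , b)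
unpair-pair a b = go (a + b) a b refl
  where
  go : ∀ d a b → a + b ≡ d → unpair (pair a b) ≡ (a , b)
  go d       a       (suc b) a+b≡d = trans (cong unpair (pair-next (suc a , b)))
                                         (cong next (go d (suc a) b (trans (sym (+-suc a b)) a+b≡d)))
  go _       zero    zero    _     = refl
  go (suc d) (suc a) zero    a+0≡d = trans (cong unpair (pair-next (zero , a)))
                                         (cong next (go d zero a a≡d))
    where
    a≡d : a ≡ d
    a≡d = suc-injective (trans (cong suc (sym (+-identityʳ a))) a+0≡d)

fst-pair : ∀ a b → fst (pair a b) ≡ a
fst-pair a b = cong proj₁ (unpair-pair a b)

snd-pair : ∀ a b → snd (pair a b) ≡ b
snd-pair a b = cong proj₂ (unpair-pair a b)

pair-injective : ∀ {a b a′ b′} → pair a b ≡ pair a′ b′ → a ≡ a′ × b ≡ b′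
pair-injective {a} {b} {a′} {b′} eq
  with trans (sym (unpair-pair a b)) (trans (cong unpair eq) (unpair-pair a′ b′))
... | refl = refl , refl

Eval-deterministic : ∀ {c x x′ y y′} → Eval c x y → Eval c x′ y′ → x ≡ x′ → y ≡ y′
Eval-deterministic ev-zer ev-zer _ = refl
Eval-deterministic ev-suc ev-suc x≡x′ = cong suc x≡x′
Eval-deterministic ev-id ev-id x≡x′ = x≡x′
Eval-deterministic (ev-left {a} {b}) (ev-left {a′} {b′}) x≡x′ =
  proj₁ (pair-injective {a} {b} {a′} {b′} x≡x′)
Eval-deterministic (ev-right {a} {b}) (ev-right {a′} {b′}) x≡x′ =
  proj₂ (pair-injective {a} {b} {a′} {b′} x≡x′)
Eval-deterministic (ev-comp g f) (ev-comp g′ f′) x≡x′ =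
  Eval-deterministic f f′ (Eval-deterministic g g′ x≡x′)
Eval-deterministic (ev-pair {a = a} {b} f g) (ev-pair {a = a′} {b′} f′ g′) x≡x′ =
  cong₂ pair {x = a} {a′} {b} {b′} (Eval-deterministic f f′ x≡x′) (Eval-deterministic g g′ x≡x′)
Eval-deterministic (ev-rec0 {x = x} f) (ev-rec0 {x = x′} f′) x≡x′ =
  Eval-deterministic f f′ (proj₁ (pair-injective {x} {0} {x′} {0} x≡x′))
Eval-deterministic (ev-rec0 {x = x} _) (ev-recS {x = x′} {n = n′} _ _) x≡x′
  with () ← proj₂ (pair-injective {x} {0} {x′} {suc n′} x≡x′)
Eval-deterministic (ev-recS {x = x} {n = n} _ _) (ev-rec0 {x = x′} _) x≡x′
  with () ← proj₂ (pair-injective {x} {suc n} {x′} {0} x≡x′)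
Eval-deterministic (ev-recS {x = x} {n = n} r g) (ev-recS {x = x′} {n = n′} r′ g′) x≡x′
  with pair-injective {x} {suc n} {x′} {suc n′} x≡x′
... | refl , refl =
  Eval-deterministic g g′ (cong (pair x) (cong (pair n) (Eval-deterministic r r′ refl)))
Eval-deterministic (ev-mu {n = n} z below) (ev-mu {n = n′} z′ below′) refl with <-cmp n n′
... | tri≈ _ n≡n′ _ = n≡n′
... | tri< n<n′ _ _ with () ← Eval-deterministic z (proj₂ (below′ n n<n′)) refl
... | tri> _ _ n′<n with () ← Eval-deterministic z′ (proj₂ (below n′ n′<n)) refl

depth : Code → ℕ
depth (comp f g)  = suc (depth f ⊔ depth g)
depth (pairᶜ f g) = suc (depth f ⊔ depth g)
depth (rec f g)   = suc (depth f ⊔ depth g)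
depth (mu f)      = suc (depth f)
depth _           = 0

-- Decoding with fuel; out-of-range tags and exhausted fuel decode to junk (zer).
decode : ℕ → ℕ → Code
decodeAt : ℕ → ℕ → ℕ → Code
decode k n = decodeAt k (fst n) (snd n)
decodeAt _       0 _ = zer
decodeAt _       1 _ = sucᶜ
decodeAt _       2 _ = idᶜ
decodeAt _       3 _ = left
decodeAt _       4 _ = right
decodeAt (suc k) 5 b = comp  (decode k (fst b)) (decode k (snd b))
decodeAt (suc k) 6 b = pairᶜ (decode k (fst b)) (decode k (snd b))
decodeAt (suc k) 7 b = rec   (decode k (fst b)) (decode k (snd b))
decodeAt (suc k) 8 b = mu    (decode k b)
decodeAt _       _ _ = zer

decode-pair : ∀ k t b → decode k (pair t b) ≡ decodeAt k t b
decode-pair k t b = cong₂ (decodeAt k) (fst-pair t b) (snd-pair t b)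

decode-⌜⌝ : ∀ c {k} → depth c ≤ k → decode k ⌜ c ⌝ ≡ c
decode-⌜⌝-args : ∀ (op : Code → Code → Code) f g {k} → depth f ⊔ depth g ≤ k →
                 op (decode k (fst (pair ⌜ f ⌝ ⌜ g ⌝))) (decode k (snd (pair ⌜ f ⌝ ⌜ g ⌝))) ≡ op f g

decode-⌜⌝ zer         _ = refl
decode-⌜⌝ sucᶜ        _ = refl
decode-⌜⌝ idᶜ         _ = refl
decode-⌜⌝ left        _ = refl
decode-⌜⌝ right       _ = refl
decode-⌜⌝ (comp f g)  {suc k} (s≤s d≤k) =
  trans (decode-pair (suc k) 5 (pair ⌜ f ⌝ ⌜ g ⌝)) (decode-⌜⌝-args comp f g d≤k)
decode-⌜⌝ (pairᶜ f g) {suc k} (s≤s d≤k) =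
  trans (decode-pair (suc k) 6 (pair ⌜ f ⌝ ⌜ g ⌝)) (decode-⌜⌝-args pairᶜ f g d≤k)
decode-⌜⌝ (rec f g)   {suc k} (s≤s d≤k) =
  trans (decode-pair (suc k) 7 (pair ⌜ f ⌝ ⌜ g ⌝)) (decode-⌜⌝-args rec f g d≤k)
decode-⌜⌝ (mu f)      {suc k} (s≤s d≤k) =
  trans (decode-pair (suc k) 8 ⌜ f ⌝) (cong mu (decode-⌜⌝ f d≤k))

decode-⌜⌝-args op f g d≤k = cong₂ op
  (trans (cong (decode _) (fst-pair ⌜ f ⌝ ⌜ g ⌝)) (decode-⌜⌝ f (m⊔n≤o⇒m≤o _ _ d≤k)))
  (trans (cong (decode _) (snd-pair ⌜ f ⌝ ⌜ g ⌝)) (decode-⌜⌝ g (m⊔n≤o⇒n≤o _ _ d≤k)))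

⌜⌝-injective : ∀ c c′ → ⌜ c ⌝ ≡ ⌜ c′ ⌝ → c ≡ c′
⌜⌝-injective c c′ eq = begin
  c                              ≡⟨ decode-⌜⌝ c (m≤m⊔n (depth c) (depth c′)) ⟨
  decode k ⌜ c ⌝                 ≡⟨ cong (decode k) eq ⟩
  decode k ⌜ c′ ⌝                ≡⟨ decode-⌜⌝ c′ (m≤n⊔m (depth c) (depth c′)) ⟩
  c′                             ∎
  where open ≡-Reasoning
        k = depth c ⊔ depth c′

φ-functional : ∀ {e x y y′} → φ e [ x ]≃ y → φ e [ x ]≃ y′ → y ≡ y′
φ-functional (c , refl , ev) (c′ , eq , ev′) with ⌜⌝-injective c′ c eq
... | refl = Eval-deterministic ev ev′ refl

uniform-code : ∀ {e} (tot : Total e) → Σ Code λ c → ⌜ c ⌝ ≡ e × (∀ x → Eval c x (proj₁ (tot x)))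
uniform-code tot = c , ⌜c⌝≡e , λ x → evaluate x (proj₂ (tot x))
  where
  c = proj₁ (proj₂ (tot 0))
  ⌜c⌝≡e = proj₁ (proj₂ (proj₂ (tot 0)))
  evaluate : ∀ x {y} → φ _ [ x ]≃ y → Eval c x y
  evaluate x (c′ , ⌜c′⌝≡e , ev) with ⌜⌝-injective c′ c (trans ⌜c′⌝≡e (sym ⌜c⌝≡e))
  ... | refl = ev

K : ℕ → Code
K zero    = zer
K (suc n) = comp sucᶜ (K n)

ev-K : ∀ n {x} → Eval (K n) x n
ev-K zero    = ev-zer
ev-K (suc n) = ev-comp (ev-K n) ev-suc

ev-fst : ∀ {X x q} → Eval X x q → Eval (comp left X) x (fst q)
ev-fst {q = q} evX =
  ev-comp evX (subst (λ p → Eval left p (fst q)) (pair-unpair q) (ev-left {fst q}))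

ev-snd : ∀ {X x q} → Eval X x q → Eval (comp right X) x (snd q)
ev-snd {q = q} evX =
  ev-comp evX (subst (λ p → Eval right p (snd q)) (pair-unpair q) (ev-right {fst q}))

ev-rec : ∀ {Z G x} (h : ℕ → ℕ) → Eval Z x (h 0) →
         (∀ n → Eval G (pair x (pair n (h n))) (h (suc n))) → ∀ n → Eval (rec Z G) (pair x n) (h n)
ev-rec {x = x} h evZ evG zero    = ev-rec0 {x = x} evZ
ev-rec {x = x} h evZ evG (suc n) = ev-recS {x = x} {n = n} (ev-rec h evZ evG n) (evG n)

RecOnInput : Code → Code → Code
RecOnInput Z G = comp (rec Z (comp G right)) (pairᶜ zer idᶜ)

ev-RecOnInput : ∀ {Z G} (h : ℕ → ℕ) → Eval Z 0 (h 0) →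
                (∀ n → Eval G (pair n (h n)) (h (suc n))) → ∀ n → Eval (RecOnInput Z G) n (h n)
ev-RecOnInput h evZ evG n =
  ev-comp (ev-pair ev-zer ev-id) (ev-rec h evZ (λ m → ev-comp (ev-right {0}) (evG m)) n)

ifz : ℕ → ℕ → ℕ → ℕ
ifz zero    u v = u
ifz (suc _) u v = v

-- Recursion on c with base case u and constant step v.
Cond : Code → Code → Code → Code
Cond C U V = comp (rec left (comp right left)) (pairᶜ (pairᶜ U V) C)

ev-Cond : ∀ {C U V x c u v} → Eval C x c → Eval U x u → Eval V x v → Eval (Cond C U V) x (ifz c u v)
ev-Cond {c = c} {u} {v} evC evU evV =
  ev-comp (ev-pair (ev-pair evU evV) evC)
          (ev-rec (λ n → ifz n u v) (ev-left {u}) (λ n → ev-comp (ev-left {pair u v}) (ev-right {u})) c)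

Pred : Code → Code
Pred X = comp (RecOnInput zer left) X

ev-Pred : ∀ {X x n} → Eval X x n → Eval (Pred X) x (pred n)
ev-Pred {n = n} evX = ev-comp evX (ev-RecOnInput pred ev-zer (λ m → ev-left {m}) n)

Monus : Code → Code → Code
Monus X Y = comp (rec idᶜ (Pred (comp right right))) (pairᶜ X Y)

ev-Monus : ∀ {X Y x a b} → Eval X x a → Eval Y x b → Eval (Monus X Y) x (a ∸ b)
ev-Monus {a = a} {b} evX evY = ev-comp (ev-pair evX evY) (ev-rec (a ∸_) ev-id monus-step b)
  where
  monus-step : ∀ n → Eval (Pred (comp right right)) (pair a (pair n (a ∸ n))) (a ∸ suc n)
  monus-step n = subst (Eval _ _) (pred[m∸n]≡m∸[1+n] a n)
                 (ev-Pred (ev-comp (ev-right {a}) (ev-right {n})))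

ifEq : ℕ → ℕ → ℕ → ℕ → ℕ
ifEq a b u v = ifz (a ∸ b) (ifz (b ∸ a) u v) v

IfEq : Code → Code → Code → Code → Code
IfEq A B U V = Cond (Monus A B) (Cond (Monus B A) U V) V

ev-IfEq : ∀ {A B U V x a b u v} → Eval A x a → Eval B x b → Eval U x u → Eval V x v →
          Eval (IfEq A B U V) x (ifEq a b u v)
ev-IfEq evA evB evU evV = ev-Cond (ev-Monus evA evB) (ev-Cond (ev-Monus evB evA) evU evV) evV

ifEq-≡ : ∀ {a b} u v → a ≡ b → ifEq a b u v ≡ u
ifEq-≡ {a} u v refl rewrite n∸n≡0 a = refl

ifEq-≢ : ∀ {a b} u v → a ≢ b → ifEq a b u v ≡ v
ifEq-≢ {a} {b} u v a≢b with a ∸ b in a∸b≡0 | b ∸ a in b∸a≡0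
... | zero  | zero  = ⊥-elim (a≢b (≤-antisym (m∸n≡0⇒m≤n a∸b≡0) (m∸n≡0⇒m≤n b∸a≡0)))
... | zero  | suc _ = refl
... | suc _ | _     = refl

-- The s-m-n theorem for fixing the first argument

specialise : Code → ℕ → Code
specialise D e = comp D (pairᶜ (K e) idᶜ)

ev-specialise : ∀ {D e z y} → Eval D (pair e z) y → Eval (specialise D e) z y
ev-specialise {e = e} evD = ev-comp (ev-pair (ev-K e) ev-id) evD

QuoteK : Code
QuoteK = RecOnInput (K ⌜ zer ⌝) (pairᶜ (K 5) (pairᶜ (K ⌜ sucᶜ ⌝) right))

ev-QuoteK : ∀ n → Eval QuoteK n ⌜ K n ⌝
ev-QuoteK = ev-RecOnInput (λ n → ⌜ K n ⌝) (ev-K ⌜ zer ⌝)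
  (λ n → ev-pair (ev-K 5) (ev-pair (ev-K ⌜ sucᶜ ⌝) (ev-right {n})))

specialise-computable : ∀ D → Computable (λ e → ⌜ specialise D e ⌝)
specialise-computable D = ⌜ Spec ⌝ , λ e → Spec , refl , ev-Spec e
  where
  -- ⌜ specialise D e ⌝ = ⟨5 , ⟨⌜ D ⌝ , ⟨6 , ⟨⌜ K e ⌝ , ⌜ idᶜ ⌝⟩⟩⟩⟩
  Spec : Code
  Spec = pairᶜ (K 5) (pairᶜ (K ⌜ D ⌝) (pairᶜ (K 6) (pairᶜ QuoteK (K ⌜ idᶜ ⌝))))
  ev-Spec : ∀ e → Eval Spec e ⌜ specialise D e ⌝
  ev-Spec e =
    ev-pair (ev-K 5) (ev-pair (ev-K ⌜ D ⌝) (ev-pair (ev-K 6) (ev-pair (ev-QuoteK e) (ev-K ⌜ idᶜ ⌝))))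

module _ (G H : Group 0ℓ 0ℓ) where
  private
    module G = Group G
    module H = Group H

  isGroupMonomorphism : (f : G.Carrier → H.Carrier) →
    (∀ {x y} → x G.≈ y → f x H.≈ f y) →
    (∀ x y → f (x G.∙ y) H.≈ f x H.∙ f y) →
    (∀ {x y} → f x H.≈ f y → x G.≈ y) →
    IsGroupMonomorphism G.rawGroup H.rawGroup f
  isGroupMonomorphism f f-cong ∙-homo f-injective = record
    { isGroupHomomorphism = record
      { isMonoidHomomorphism = record
        { isMagmaHomomorphism = record
          { isRelHomomorphism = record { cong = f-cong }
          ; homo = ∙-homo }
        ; ε-homo = ε-homo }
      ; ⁻¹-homo = λ x → GroupProperties.inverseˡ-unique H (f (x G.⁻¹)) (f x)
          (H.trans (H.sym (∙-homo (x G.⁻¹) x)) (H.trans (f-cong (G.inverseˡ x)) ε-homo)) }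
    ; injective = f-injective }
    where
    ε-homo : f G.ε H.≈ H.ε
    ε-homo = GroupProperties.identityˡ-unique H (f G.ε) (f G.ε)
               (H.trans (H.sym (∙-homo G.ε G.ε)) (f-cong (G.identityˡ G.ε)))

  isGroupIsomorphism : (f : G.Carrier → H.Carrier) →
    (∀ {x y} → x G.≈ y → f x H.≈ f y) →
    (∀ x y → f (x G.∙ y) H.≈ f x H.∙ f y) →
    (∀ {x y} → f x H.≈ f y → x G.≈ y) →
    (∀ y → ∃ λ x → f x H.≈ y) →
    IsGroupIsomorphism G.rawGroup H.rawGroup f
  isGroupIsomorphism f f-cong ∙-homo f-injective f-surjective = record
    { isGroupMonomorphism = isGroupMonomorphism f f-cong ∙-homo f-injective
    ; surjective = λ y → let (x , fx≈y) = f-surjective y in x , λ z≈x → H.trans (f-cong z≈x) fx≈y }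

toGroup-unique : ∀ {e} (w w′ : IsCompGroup e) → toGroup w ≅ toGroup w′
toGroup-unique w w′ = f , isGroupIsomorphism (toGroup w) (toGroup w′) f id
  (λ x y → val≗val′ (pair 1 (pair (proj₁ x) (proj₁ y)))) id
  (λ (y , y∈) → (y , subst (_≡ 0) (sym (val≗val′ _)) y∈) , refl)
  where
  val≗val′ : ∀ z → IsCompGroup.val w z ≡ IsCompGroup.val w′ z
  val≗val′ z = φ-functional (proj₂ (IsCompGroup.total w z)) (proj₂ (IsCompGroup.total w′ z))
  f : Group.Carrier (toGroup w) → Group.Carrier (toGroup w′)
  f x = proj₁ x , subst (_≡ 0) (val≗val′ _) (proj₂ x)

-- The group Gₑ, with χ n ≢ 0 standing for ¬ R(e,n)

module StageGroup {e₊ e₋} (w₊ : IsCompGroup e₊) (w₋ : IsCompGroup e₋) (χ : ℕ → ℕ) where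

  private
    v₊ = IsCompGroup.val w₊
    v₋ = IsCompGroup.val w₋
    module ₊ = Diagram.GroupAxioms (IsCompGroup.axioms w₊)
    module ₋ = Diagram.GroupAxioms (IsCompGroup.axioms w₋)
  open Diagram v₊ using () renaming (mem to mem₊; mul to _·₊_)
  open Diagram v₋ using () renaming (mem to mem₋; mul to _·₋_)

  -- F n = 0 as long as χ vanishes below n; afterwards F keeps the first nonzero value of χ.
  F : ℕ → ℕ
  F zero    = 0
  F (suc n) = ifz (F n) (χ n) (F n)

  F-suc≡0 : ∀ n → F (suc n) ≡ 0 → F n ≡ 0
  F-suc≡0 n F[1+n]≡0 with F n
  ... | zero = refl
  ... | suc _ with () ← F[1+n]≡0

  F-≤≡0 : ∀ {m n} → m ≤ n → F n ≡ 0 → F m ≡ 0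
  F-≤≡0 m≤n = go (≤⇒≤′ m≤n)
    where
    go : ∀ {m n} → m ≤′ n → F n ≡ 0 → F m ≡ 0
    go ≤′-refl           Fn≡0     = Fn≡0
    go (≤′-step {n} m≤n) F[1+n]≡0 = go m≤n (F-suc≡0 n F[1+n]≡0)

  F-vanishes : (∀ n → χ n ≡ 0) → ∀ n → F n ≡ 0
  F-vanishes χ≡0 zero    = refl
  F-vanishes χ≡0 (suc n) rewrite F-vanishes χ≡0 n = χ≡0 n

  F-fails : ∀ {n} → χ n ≢ 0 → F (suc n) ≢ 0
  F-fails {n} χn≢0 with F n
  ... | zero  = χn≢0
  ... | suc _ = λ ()

  -- s = 1 + the least n with χ n ≢ 0
  FailureStage : ℕ → Set
  FailureStage s = F (pred s) ≡ 0 × F s ≢ 0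

  FailureStage-nonzero : ∀ {s} → FailureStage s → s ≢ 0
  FailureStage-nonzero (_ , F0≢0) refl = F0≢0 refl

  FailureStage-unique : ∀ {s t} → FailureStage s → FailureStage t → s ≡ t
  FailureStage-unique {zero} fs _ = ⊥-elim (FailureStage-nonzero fs refl)
  FailureStage-unique {suc _} {zero} _ ft = ⊥-elim (FailureStage-nonzero ft refl)
  FailureStage-unique {suc m} {suc n} (Fm≡0 , F[1+m]≢0) (Fn≡0 , F[1+n]≢0) with <-cmp m n
  ... | tri< m<n _ _ = ⊥-elim (F[1+m]≢0 (F-≤≡0 m<n Fn≡0))
  ... | tri≈ _ m≡n _ = cong suc m≡n
  ... | tri> _ _ n<m = ⊥-elim (F[1+n]≢0 (F-≤≡0 n<m Fm≡0))

  no-FailureStage : (∀ n → χ n ≡ 0) → ∀ s → ¬ FailureStage s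
  no-FailureStage χ≡0 s (_ , Fs≢0) = Fs≢0 (F-vanishes χ≡0 s)

  FailureStage-exists : ∀ {n} → χ n ≢ 0 → Σ ℕ FailureStage
  FailureStage-exists {n} χn≢0 = search (suc n) (F-fails χn≢0)
    where
    search : ∀ m → F m ≢ 0 → Σ ℕ FailureStage
    search zero    F0≢0 = ⊥-elim (F0≢0 refl)
    search (suc m) F[1+m]≢0 with F m ≟ 0
    ... | yes Fm≡0 = suc m , Fm≡0 , F[1+m]≢0
    ... | no Fm≢0  = search m Fm≢0

  data ValidTag (b s : ℕ) : Set where
    at-unit  : b ≡ ₋.unit → s ≡ 0 → ValidTag b s
    off-unit : b ≢ ₋.unit → FailureStage s → ValidTag b s

  ValidTag-unique : ∀ {b s t} → ValidTag b s → ValidTag b t → s ≡ t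
  ValidTag-unique (at-unit _ s≡0)   (at-unit _ t≡0)   = trans s≡0 (sym t≡0)
  ValidTag-unique (at-unit b≡1 _)   (off-unit b≢1 _)  = ⊥-elim (b≢1 b≡1)
  ValidTag-unique (off-unit b≢1 _)  (at-unit b≡1 _)   = ⊥-elim (b≢1 b≡1)
  ValidTag-unique (off-unit _ fs)   (off-unit _ ft)   = FailureStage-unique fs ft

  stageCheck : ℕ → ℕ
  stageCheck s = ifz (F (pred s)) (ifz (F s) 1 0) 1

  stageCheck-sound : ∀ s → stageCheck s ≡ 0 → FailureStage s
  stageCheck-sound s check≡0 with F (pred s) | F s
  ... | zero | suc _ = refl , λ ()

  stageCheck-complete : ∀ s → FailureStage s → stageCheck s ≡ 0
  stageCheck-complete s (F[s-1]≡0 , Fs≢0) with F (pred s) | F s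
  ... | zero  | zero  = ⊥-elim (Fs≢0 refl)
  ... | zero  | suc _ = refl

  tagCheck : ℕ → ℕ → ℕ
  tagCheck b s = ifEq b ₋.unit s (stageCheck s)

  tagCheck-sound : ∀ b s → tagCheck b s ≡ 0 → ValidTag b s
  tagCheck-sound b s check≡0 with b ≟ ₋.unit
  ... | yes b≡1 = at-unit b≡1 (trans (sym (ifEq-≡ s (stageCheck s) b≡1)) check≡0)
  ... | no  b≢1 = off-unit b≢1 (stageCheck-sound s (trans (sym (ifEq-≢ s (stageCheck s) b≢1)) check≡0))

  tagCheck-complete : ∀ {b s} → ValidTag b s → tagCheck b s ≡ 0
  tagCheck-complete {s = s} (at-unit b≡1 s≡0)  = trans (ifEq-≡ s (stageCheck s) b≡1) s≡0
  tagCheck-complete {s = s} (off-unit b≢1 fs)  = trans (ifEq-≢ s (stageCheck s) b≢1) (stageCheck-complete s fs)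

  ValidTag-exists : Σ ℕ FailureStage → ∀ b → Σ ℕ (ValidTag b)
  ValidTag-exists (s₀ , fs) b with b ≟ ₋.unit
  ... | yes b≡1 = 0 , at-unit b≡1 refl
  ... | no  b≢1 = s₀ , off-unit b≢1 fs

  mulTag : ℕ → ℕ → ℕ → ℕ
  mulTag b s t = ifEq b ₋.unit 0 (ifz s t s)

  ValidTag-product-stage : ∀ {b c s t} → mem₋ c → b ·₋ c ≢ ₋.unit →
                          ValidTag b s → ValidTag c t → FailureStage (ifz s t s)
  ValidTag-product-stage {c = c} c∈ bc≢1 (at-unit refl refl) (at-unit c≡1 _) =
    ⊥-elim (bc≢1 (trans (₋.identityˡ c c∈) c≡1))
  ValidTag-product-stage _ _ (at-unit _ refl) (off-unit _ ft) = ft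
  ValidTag-product-stage {s = zero}  _ _ (off-unit _ fs) _ = ⊥-elim (FailureStage-nonzero fs refl)
  ValidTag-product-stage {s = suc _} _ _ (off-unit _ fs) _ = fs

  ValidTag-mul : ∀ {b c s t} → mem₋ c → ValidTag b s → ValidTag c t → ValidTag (b ·₋ c) (mulTag (b ·₋ c) s t)
  ValidTag-mul {b} {c} {s} {t} c∈ vs vt with b ·₋ c ≟ ₋.unit
  ... | yes bc≡1 = at-unit bc≡1 (ifEq-≡ 0 (ifz s t s) bc≡1)
  ... | no  bc≢1 = off-unit bc≢1
        (subst FailureStage (sym (ifEq-≢ 0 (ifz s t s) bc≢1)) (ValidTag-product-stage c∈ bc≢1 vs vt))

  A B S : ℕ → ℕ
  A x = fst x
  B x = fst (snd x)
  S x = snd (snd x)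

  -- Opaque: otherwise unifying two triples unfolds the pairing arithmetic, which is prohibitively slow.
  opaque
    triple : ℕ → ℕ → ℕ → ℕ
    triple a b s = pair a (pair b s)

    triple-≡ : ∀ a b s → triple a b s ≡ pair a (pair b s)
    triple-≡ a b s = refl

    A-triple : ∀ a b s → A (triple a b s) ≡ a
    A-triple a b s = fst-pair a (pair b s)

    B-triple : ∀ a b s → B (triple a b s) ≡ b
    B-triple a b s = trans (cong fst (snd-pair a (pair b s))) (fst-pair b s)

    S-triple : ∀ a b s → S (triple a b s) ≡ s
    S-triple a b s = trans (cong snd (snd-pair a (pair b s))) (snd-pair b s)

    triple-ABS : ∀ x → triple (A x) (B x) (S x) ≡ x
    triple-ABS x = trans (cong (pair (fst x)) (pair-unpair (snd x))) (pair-unpair x)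

  record Member (x : ℕ) : Set where
    field
      A-mem : mem₊ (A x)
      B-mem : mem₋ (B x)
      valid : ValidTag (B x) (S x)
  open Member

  Member-triple : ∀ {a b s} → mem₊ a → mem₋ b → ValidTag b s → Member (triple a b s)
  Member-triple {a} {b} {s} a∈ b∈ v = record
    { A-mem = subst mem₊ (sym (A-triple a b s)) a∈
    ; B-mem = subst mem₋ (sym (B-triple a b s)) b∈
    ; valid = subst₂ ValidTag (sym (B-triple a b s)) (sym (S-triple a b s)) v }

  Member-≡ : ∀ {x y} → Member x → Member y → A x ≡ A y → B x ≡ B y → x ≡ y
  Member-≡ {x} {y} x∈ y∈ Ax≡Ay Bx≡By = begin
    x                              ≡⟨ triple-ABS x ⟨
    triple (A x) (B x) (S x)       ≡⟨ cong₂ (λ a b → triple a b (S x)) Ax≡Ay Bx≡By ⟩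
    triple (A y) (B y) (S x)       ≡⟨ cong (triple (A y) (B y)) Sx≡Sy ⟩
    triple (A y) (B y) (S y)       ≡⟨ triple-ABS y ⟩
    y                              ∎
    where
    open ≡-Reasoning
    Sx≡Sy : S x ≡ S y
    Sx≡Sy = ValidTag-unique (valid x∈) (subst (λ b → ValidTag b (S y)) (sym Bx≡By) (valid y∈))

  member? : ℕ → ℕ
  member? x = ifz (v₊ (pair 0 (A x))) (ifz (v₋ (pair 0 (B x))) (tagCheck (B x) (S x)) 1) 1

  member?-sound : ∀ x → member? x ≡ 0 → Member x
  member?-sound x check≡0 with v₊ (pair 0 (A x)) in a∈ | v₋ (pair 0 (B x)) in b∈
  ... | zero | zero = record { A-mem = a∈ ; B-mem = b∈ ; valid = tagCheck-sound (B x) (S x) check≡0 }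

  member?-complete : ∀ {x} → Member x → member? x ≡ 0
  member?-complete x∈ rewrite A-mem x∈ | B-mem x∈ = tagCheck-complete (valid x∈)

  opaque
    _·_ : ℕ → ℕ → ℕ
    x · y = triple (A x ·₊ A y) (B x ·₋ B y) (mulTag (B x ·₋ B y) (S x) (S y))

    ·-≡-triple : ∀ x y → x · y ≡ triple (A x ·₊ A y) (B x ·₋ B y) (mulTag (B x ·₋ B y) (S x) (S y))
    ·-≡-triple x y = refl

    A-· : ∀ x y → A (x · y) ≡ A x ·₊ A y
    A-· x y = A-triple (A x ·₊ A y) (B x ·₋ B y) (mulTag (B x ·₋ B y) (S x) (S y))

    B-· : ∀ x y → B (x · y) ≡ B x ·₋ B y
    B-· x y = B-triple (A x ·₊ A y) (B x ·₋ B y) (mulTag (B x ·₋ B y) (S x) (S y))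

    Member-· : ∀ {x y} → Member x → Member y → Member (x · y)
    Member-· {x} {y} x∈ y∈ = Member-triple
      (₊.closed (A x) (A y) (A-mem x∈) (A-mem y∈)) (₋.closed (B x) (B y) (B-mem x∈) (B-mem y∈))
      (ValidTag-mul (B-mem y∈) (valid x∈) (valid y∈))

  ·-≡ : ∀ {x y z} → Member x → Member y → Member z →
        A x ·₊ A y ≡ A z → B x ·₋ B y ≡ B z → x · y ≡ z
  ·-≡ {x} {y} x∈ y∈ z∈ eqA eqB =
    Member-≡ (Member-· x∈ y∈) z∈ (trans (A-· x y) eqA) (trans (B-· x y) eqB)

  one : ℕ
  one = triple ₊.unit ₋.unit 0

  Member-one : Member one
  Member-one = Member-triple ₊.unit-mem ₋.unit-mem (at-unit refl refl)

  A-one : A one ≡ ₊.unit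
  A-one = A-triple ₊.unit ₋.unit 0

  B-one : B one ≡ ₋.unit
  B-one = B-triple ₊.unit ₋.unit 0

  ·-identityˡ : ∀ {x} → Member x → one · x ≡ x
  ·-identityˡ {x} x∈ = ·-≡ Member-one x∈ x∈
    (trans (cong (_·₊ A x) A-one) (₊.identityˡ (A x) (A-mem x∈)))
    (trans (cong (_·₋ B x) B-one) (₋.identityˡ (B x) (B-mem x∈)))

  ·-identityʳ : ∀ {x} → Member x → x · one ≡ x
  ·-identityʳ {x} x∈ = ·-≡ x∈ Member-one x∈
    (trans (cong (A x ·₊_) A-one) (₊.identityʳ (A x) (A-mem x∈)))
    (trans (cong (B x ·₋_) B-one) (₋.identityʳ (B x) (B-mem x∈)))


  ·-assoc : ∀ {x y z} → Member x → Member y → Member z → (x · y) · z ≡ x · (y · z)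
  ·-assoc {x} {y} {z} x∈ y∈ z∈ =
    ·-≡ (Member-· x∈ y∈) z∈ (Member-· x∈ (Member-· y∈ z∈)) eqA eqB
    where
    open ≡-Reasoning
    eqA : A (x · y) ·₊ A z ≡ A (x · (y · z))
    eqA = begin
      A (x · y) ·₊ A z         ≡⟨ cong (_·₊ A z) (A-· x y) ⟩
      (A x ·₊ A y) ·₊ A z      ≡⟨ ₊.assoc (A x) (A y) (A z) (A-mem x∈) (A-mem y∈) (A-mem z∈) ⟩
      A x ·₊ (A y ·₊ A z)      ≡⟨ cong (A x ·₊_) (A-· y z) ⟨
      A x ·₊ A (y · z)         ≡⟨ A-· x (y · z) ⟨
      A (x · (y · z))          ∎
    eqB : B (x · y) ·₋ B z ≡ B (x · (y · z))
    eqB = begin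
      B (x · y) ·₋ B z         ≡⟨ cong (_·₋ B z) (B-· x y) ⟩
      (B x ·₋ B y) ·₋ B z      ≡⟨ ₋.assoc (B x) (B y) (B z) (B-mem x∈) (B-mem y∈) (B-mem z∈) ⟩
      B x ·₋ (B y ·₋ B z)      ≡⟨ cong (B x ·₋_) (B-· y z) ⟨
      B x ·₋ B (y · z)         ≡⟨ B-· x (y · z) ⟨
      B (x · (y · z))          ∎


  ValidTag-inverse : ∀ {b b′ s} → mem₋ b → mem₋ b′ → b′ ·₋ b ≡ ₋.unit → b ·₋ b′ ≡ ₋.unit →
                     ValidTag b s → ValidTag b′ s
  ValidTag-inverse {b} {b′} b∈ b′∈ b′b≡1 bb′≡1 (at-unit refl s≡0) =
    at-unit (trans (sym (₋.identityˡ b′ b′∈)) bb′≡1) s≡0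
  ValidTag-inverse {b} {b′} b∈ b′∈ b′b≡1 bb′≡1 (off-unit b≢1 fs) =
    off-unit (λ { refl → b≢1 (trans (sym (₋.identityˡ b b∈)) b′b≡1) }) fs

  ·-inverse : ∀ {x} → Member x → Σ ℕ λ y → Member y × y · x ≡ one × x · y ≡ one
  ·-inverse {x} x∈ = y , y∈ , ·-≡ y∈ x∈ Member-one eqAˡ eqBˡ , ·-≡ x∈ y∈ Member-one eqAʳ eqBʳ
    where
    a′ = proj₁ (₊.inverse (A x) (A-mem x∈))
    b′ = proj₁ (₋.inverse (B x) (B-mem x∈))
    a′-prop = proj₂ (₊.inverse (A x) (A-mem x∈))
    b′-prop = proj₂ (₋.inverse (B x) (B-mem x∈))
    y = triple a′ b′ (S x)
    y∈ : Member y
    y∈ = Member-triple (proj₁ a′-prop) (proj₁ b′-prop)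
           (ValidTag-inverse (B-mem x∈) (proj₁ b′-prop) (proj₁ (proj₂ b′-prop)) (proj₂ (proj₂ b′-prop)) (valid x∈))
    eqAˡ : A y ·₊ A x ≡ A one
    eqAˡ = trans (cong (_·₊ A x) (A-triple a′ b′ (S x))) (trans (proj₁ (proj₂ a′-prop)) (sym A-one))
    eqBˡ : B y ·₋ B x ≡ B one
    eqBˡ = trans (cong (_·₋ B x) (B-triple a′ b′ (S x))) (trans (proj₁ (proj₂ b′-prop)) (sym B-one))
    eqAʳ : A x ·₊ A y ≡ A one
    eqAʳ = trans (cong (A x ·₊_) (A-triple a′ b′ (S x))) (trans (proj₂ (proj₂ a′-prop)) (sym A-one))
    eqBʳ : B x ·₋ B y ≡ B one
    eqBʳ = trans (cong (B x ·₋_) (B-triple a′ b′ (S x))) (trans (proj₂ (proj₂ b′-prop)) (sym B-one))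

  D : ℕ → ℕ
  D z = ifz (fst z) (member? (snd z)) (fst (snd z) · snd (snd z))

  D-pair : ∀ i q → D (pair i q) ≡ ifz i (member? q) (fst q · snd q)
  D-pair i q = cong₂ (λ i q → ifz i (member? q) (fst q · snd q)) (fst-pair i q) (snd-pair i q)

  open Diagram D using () renaming (mem to memD; mul to mulD)

  memD⇒Member : ∀ {x} → memD x → Member x
  memD⇒Member {x} x∈ = member?-sound x (trans (sym (D-pair 0 x)) x∈)

  Member⇒memD : ∀ {x} → Member x → memD x
  Member⇒memD {x} x∈ = trans (D-pair 0 x) (member?-complete x∈)

  mulD≡· : ∀ x y → mulD x y ≡ x · y
  mulD≡· x y = trans (D-pair 1 (pair x y)) (cong₂ _·_ (fst-pair x y) (snd-pair x y))

  D-groupAxioms : Diagram.GroupAxioms D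
  D-groupAxioms = record
    { closed    = λ x y x∈ y∈ →
        subst memD (sym (mulD≡· x y)) (Member⇒memD (Member-· (memD⇒Member x∈) (memD⇒Member y∈)))
    ; assoc     = assoc
    ; unit      = one
    ; unit-mem  = Member⇒memD Member-one
    ; identityˡ = λ x x∈ → trans (mulD≡· one x) (·-identityˡ (memD⇒Member x∈))
    ; identityʳ = λ x x∈ → trans (mulD≡· x one) (·-identityʳ (memD⇒Member x∈))
    ; inverse   = inverse
    }
    where
    assoc : ∀ x y z → memD x → memD y → memD z → mulD (mulD x y) z ≡ mulD x (mulD y z)
    assoc x y z x∈ y∈ z∈ = begin
      mulD (mulD x y) z  ≡⟨ mulD≡· (mulD x y) z ⟩
      mulD x y · z       ≡⟨ cong (_· z) (mulD≡· x y) ⟩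
      (x · y) · z        ≡⟨ ·-assoc (memD⇒Member x∈) (memD⇒Member y∈) (memD⇒Member z∈) ⟩
      x · (y · z)        ≡⟨ cong (x ·_) (mulD≡· y z) ⟨
      x · mulD y z       ≡⟨ mulD≡· x (mulD y z) ⟨
      mulD x (mulD y z)  ∎
      where open ≡-Reasoning
    inverse : ∀ x → memD x → Σ ℕ λ y → memD y × mulD y x ≡ one × mulD x y ≡ one
    inverse x x∈ with ·-inverse (memD⇒Member x∈)
    ... | y , y∈ , yx≡1 , xy≡1 =
      y , Member⇒memD y∈ , trans (mulD≡· y x) yx≡1 , trans (mulD≡· x y) xy≡1

  module _ {i} (computesD : ∀ z → φ i [ z ]≃ D z) where

    stageGroup : IsCompGroup i
    stageGroup = record { total = λ z → D z , computesD z ; axioms = D-groupAxioms }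

    ≅-if-χ-vanishes : (∀ n → χ n ≡ 0) → toGroup w₊ ≅ toGroup stageGroup
    ≅-if-χ-vanishes χ≡0 = f , isGroupIsomorphism (toGroup w₊) (toGroup stageGroup) f
      (cong ι) homo (λ ιa≡ιb → trans (sym (A-triple _ _ 0)) (trans (cong A ιa≡ιb) (A-triple _ _ 0))) surjective
      where
      ι : ℕ → ℕ
      ι a = triple a ₋.unit 0
      ι-Member : ∀ {a} → mem₊ a → Member (ι a)
      ι-Member a∈ = Member-triple a∈ ₋.unit-mem (at-unit refl refl)
      f : Group.Carrier (toGroup w₊) → Group.Carrier (toGroup stageGroup)
      f x = ι (proj₁ x) , Member⇒memD (ι-Member (proj₂ x))
      homo : ∀ x y → ι (proj₁ x ·₊ proj₁ y) ≡ mulD (ι (proj₁ x)) (ι (proj₁ y))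
      homo (a , a∈) (b , b∈) = sym (trans (mulD≡· (ι a) (ι b))
        (·-≡ (ι-Member a∈) (ι-Member b∈) (ι-Member (₊.closed a b a∈ b∈))
          (trans (cong₂ _·₊_ (A-triple a ₋.unit 0) (A-triple b ₋.unit 0)) (sym (A-triple (a ·₊ b) ₋.unit 0)))
          (trans (cong₂ _·₋_ (B-triple a ₋.unit 0) (B-triple b ₋.unit 0))
                 (trans (₋.identityˡ ₋.unit ₋.unit-mem) (sym (B-triple (a ·₊ b) ₋.unit 0))))))
      surjective : ∀ y → Σ (Group.Carrier (toGroup w₊)) λ x → proj₁ (f x) ≡ proj₁ y
      surjective (x , x∈D) with memD⇒Member x∈D
      ... | x∈ with valid x∈
      ...   | off-unit _ stage = ⊥-elim (no-FailureStage χ≡0 (S x) stage)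
      ...   | at-unit Bx≡1 _   = (A x , A-mem x∈) ,
              Member-≡ (ι-Member (A-mem x∈)) x∈ (A-triple (A x) ₋.unit 0)
                       (trans (B-triple (A x) ₋.unit 0) (sym Bx≡1))

    embeds-if-χ-fails : ∀ {n} → χ n ≢ 0 → Embeds (toGroup w₋) (toGroup stageGroup)
    embeds-if-χ-fails χn≢0 = f , isGroupMonomorphism (toGroup w₋) (toGroup stageGroup) f
      (cong ι) homo (λ ιb≡ιc → trans (sym (B-ι _)) (trans (cong B ιb≡ιc) (B-ι _)))
      where
      tag : ∀ b → Σ ℕ (ValidTag b)
      tag = ValidTag-exists (FailureStage-exists χn≢0)
      tagFor : ℕ → ℕ
      tagFor b = proj₁ (tag b)
      ι : ℕ → ℕ
      ι b = triple ₊.unit b (tagFor b)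
      ι-Member : ∀ {b} → mem₋ b → Member (ι b)
      ι-Member {b} b∈ = Member-triple ₊.unit-mem b∈ (proj₂ (tag b))
      A-ι : ∀ b → A (ι b) ≡ ₊.unit
      A-ι b = A-triple ₊.unit b (tagFor b)
      B-ι : ∀ b → B (ι b) ≡ b
      B-ι b = B-triple ₊.unit b (tagFor b)
      f : Group.Carrier (toGroup w₋) → Group.Carrier (toGroup stageGroup)
      f x = ι (proj₁ x) , Member⇒memD (ι-Member (proj₂ x))
      homo : ∀ x y → ι (proj₁ x ·₋ proj₁ y) ≡ mulD (ι (proj₁ x)) (ι (proj₁ y))
      homo (b , b∈) (c , c∈) = sym (trans (mulD≡· (ι b) (ι c))
        (·-≡ (ι-Member b∈) (ι-Member c∈) (ι-Member (₋.closed b c b∈ c∈))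
          (trans (cong₂ _·₊_ (A-ι b) (A-ι c)) (trans (₊.identityˡ ₊.unit ₊.unit-mem) (sym (A-ι (b ·₋ c)))))
          (trans (cong₂ _·₋_ (B-ι b) (B-ι c)) (sym (B-ι (b ·₋ c))))))

module Reduction {e₊ e₋ r} (w₊ : IsCompGroup e₊) (w₋ : IsCompGroup e₋) (r-total : Total r) where

  χ : ℕ → ℕ → ℕ
  χ e n = proj₁ (r-total (pair e n))

  module SG (e : ℕ) = StageGroup w₊ w₋ (χ e)

  private
    v₊ = IsCompGroup.val w₊
    v₋ = IsCompGroup.val w₋
    c₊ = proj₁ (uniform-code (IsCompGroup.total w₊))
    c₋ = proj₁ (uniform-code (IsCompGroup.total w₋))
    cr = proj₁ (uniform-code r-total)
    u  = Diagram.GroupAxioms.unit (IsCompGroup.axioms w₋)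

  call₊ call₋ : ℕ → Code → Code
  call₊ i X = comp c₊ (pairᶜ (K i) X)
  call₋ i X = comp c₋ (pairᶜ (K i) X)

  ev-call₊ : ∀ {X x y} i → Eval X x y → Eval (call₊ i X) x (v₊ (pair i y))
  ev-call₊ i evX = ev-comp (ev-pair (ev-K i) evX) (proj₂ (proj₂ (uniform-code (IsCompGroup.total w₊))) _)

  ev-call₋ : ∀ {X x y} i → Eval X x y → Eval (call₋ i X) x (v₋ (pair i y))
  ev-call₋ i evX = ev-comp (ev-pair (ev-K i) evX) (proj₂ (proj₂ (uniform-code (IsCompGroup.total w₋))) _)

  FProg : Code
  FProg = rec (K 0) (Cond (comp right right) (comp cr (pairᶜ left (comp left right))) (comp right right))

  ev-FProg : ∀ e n → Eval FProg (pair e n) (SG.F e n)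
  ev-FProg e = ev-rec {x = e} (SG.F e) (ev-K 0) λ n →
    let ev-snd-input = ev-right {e} {pair n (SG.F e n)} in
    ev-Cond (ev-comp ev-snd-input (ev-right {n}))
            (ev-comp (ev-pair (ev-left {e}) (ev-comp ev-snd-input (ev-left {n} {SG.F e n})))
                     (proj₂ (proj₂ (uniform-code r-total)) (pair e n)))
            (ev-comp ev-snd-input (ev-right {n}))

  Aᶜ Bᶜ Sᶜ : Code → Code
  Aᶜ X = comp left X
  Bᶜ X = comp left (comp right X)
  Sᶜ X = comp right (comp right X)

  FAt : Code → Code
  FAt X = comp FProg (pairᶜ left X)

  StageCheck : Code → Code
  StageCheck X = Cond (FAt (Pred X)) (Cond (FAt X) (K 1) (K 0)) (K 1)

  MemberCheck : Code → Code
  MemberCheck X = Cond (call₊ 0 (Aᶜ X))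
                       (Cond (call₋ 0 (Bᶜ X)) (IfEq (Bᶜ X) (K u) (Sᶜ X) (StageCheck (Sᶜ X))) (K 1))
                       (K 1)

  Mul : Code → Code → Code
  Mul X Y = pairᶜ (call₊ 1 (pairᶜ (Aᶜ X) (Aᶜ Y)))
                  (pairᶜ Bxy (IfEq Bxy (K u) (K 0) (Cond (Sᶜ X) (Sᶜ Y) (Sᶜ X))))
    where Bxy = call₋ 1 (pairᶜ (Bᶜ X) (Bᶜ Y))

  module _ (e : ℕ) where
    open SG e

    ev-A : ∀ {X x q} → Eval X x q → Eval (Aᶜ X) x (A q)
    ev-A = ev-fst

    ev-B : ∀ {X x q} → Eval X x q → Eval (Bᶜ X) x (B q)
    ev-B evX = ev-fst (ev-snd evX)

    ev-S : ∀ {X x q} → Eval X x q → Eval (Sᶜ X) x (S q)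
    ev-S evX = ev-snd (ev-snd evX)

    ev-FAt : ∀ {X z n} → Eval X (pair e z) n → Eval (FAt X) (pair e z) (F n)
    ev-FAt {z = z} {n} evX = ev-comp (ev-pair (ev-left {e} {z}) evX) (ev-FProg e n)

    ev-StageCheck : ∀ {X z s} → Eval X (pair e z) s → Eval (StageCheck X) (pair e z) (stageCheck s)
    ev-StageCheck evX = ev-Cond (ev-FAt (ev-Pred evX)) (ev-Cond (ev-FAt evX) (ev-K 1) (ev-K 0)) (ev-K 1)

    ev-MemberCheck : ∀ {X z q} → Eval X (pair e z) q → Eval (MemberCheck X) (pair e z) (member? q)
    ev-MemberCheck evX =
      ev-Cond (ev-call₊ 0 (ev-A evX))
              (ev-Cond (ev-call₋ 0 (ev-B evX))
                       (ev-IfEq (ev-B evX) (ev-K u) (ev-S evX) (ev-StageCheck (ev-S evX)))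
                       (ev-K 1))
              (ev-K 1)

    ev-Mul : ∀ {X Y x p q} → Eval X x p → Eval Y x q → Eval (Mul X Y) x (p · q)
    ev-Mul {p = p} {q} evX evY = subst (Eval _ _) (sym (trans (·-≡-triple p q) (triple-≡ _ _ _)))
      (ev-pair (ev-call₊ 1 (ev-pair (ev-A evX) (ev-A evY)))
               (ev-pair evBxy (ev-IfEq evBxy (ev-K u) (ev-K 0) (ev-Cond (ev-S evX) (ev-S evY) (ev-S evX)))))
      where evBxy = ev-call₋ 1 (ev-pair (ev-B evX) (ev-B evY))

  -- Opaque so that the conversion checker never evaluates the numeral ⌜ Stage ⌝.
  opaque
    Stage : Code
    Stage = Cond (comp left right) (MemberCheck (comp right right))
                 (Mul (comp left (comp right right)) (comp right (comp right right)))

    ev-Stage : ∀ e z → Eval Stage (pair e z) (SG.D e z)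
    ev-Stage e z =
      ev-Cond (ev-fst (ev-right {e} {z}))
              (ev-MemberCheck e (ev-snd (ev-right {e} {z})))
              (ev-Mul e (ev-fst (ev-snd (ev-right {e} {z}))) (ev-snd (ev-snd (ev-right {e} {z}))))

  reduce : ℕ → ℕ
  reduce e = ⌜ specialise Stage e ⌝

  reduce-computable : Computable reduce
  reduce-computable = specialise-computable Stage

  reduce-computesD : ∀ e z → φ reduce e [ z ]≃ SG.D e z
  reduce-computesD e z = specialise Stage e , refl , ev-specialise (ev-Stage e z)

  reduce-group : ∀ e → IsCompGroup (reduce e)
  reduce-group e = SG.stageGroup e (reduce-computesD e)

  Π⇒χ≡0 : ∀ e → (∀ n → φ r [ pair e n ]≃ 0) → ∀ n → χ e n ≡ 0
  Π⇒χ≡0 e Π n = φ-functional (proj₂ (r-total (pair e n))) (Π n)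

  φ≃0-or-χ≢0 : ∀ e n → φ r [ pair e n ]≃ 0 ⊎ χ e n ≢ 0
  φ≃0-or-χ≢0 e n with χ e n in χ≡
  ... | zero  = inj₁ (subst (φ r [ pair e n ]≃_) χ≡ (proj₂ (r-total (pair e n))))
  ... | suc _ = inj₂ λ ()

mainTheorem9 : {p : Level} (P : Group 0ℓ 0ℓ → Set p) → IsoInvariant P →
    (e₊ e₋ : ℕ) (w₊ : IsCompGroup e₊) (w₋ : IsCompGroup e₋) →
    Markov P (toGroup w₊) (toGroup w₋) →
    Π⁰₁-hard P
mainTheorem9 P P-invariant e₊ e₋ w₊ w₋ markov S (r , r-total , S⇔Π) =
  reduce , reduce-computable , reduce-group , λ e → mk⇔ (S⇒P e) (P⇒S e)
  where
  open Reduction w₊ w₋ r-total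
  S⇒P : ∀ e → S e → HasP P (reduce e)
  S⇒P e e∈S = reduce-group e , P-invariant _ _ G₊≅Gₑ (Markov.positive markov)
    where
    G₊≅Gₑ = SG.≅-if-χ-vanishes e (reduce-computesD e) (Π⇒χ≡0 e (Equivalence.to (S⇔Π e) e∈S))
  P⇒S : ∀ e → HasP P (reduce e) → S e
  P⇒S e (w , Pw) = Equivalence.from (S⇔Π e) λ n →
    [ id , (λ χ≢0 → ⊥-elim (¬P[Gₑ] χ≢0 P[Gₑ])) ]′ (φ≃0-or-χ≢0 e n)
    where
    P[Gₑ] : P (toGroup (reduce-group e))
    P[Gₑ] = P-invariant _ _ (toGroup-unique w (reduce-group e)) Pw
    ¬P[Gₑ] : ∀ {n} → χ e n ≢ 0 → ¬ P (toGroup (reduce-group e))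
    ¬P[Gₑ] χ≢0 = Markov.negative markov _ (SG.embeds-if-χ-fails e (reduce-computesD e) χ≢0)
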